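{- For every dyadic rational $\frac{a}{2^n}$ (with $a$ an integer and $n\ge 0$ an integer) there exists an SP-game $G$ such that $G=\frac{a}{2^n}$.
   Context: Games are two-player (Left, Right) short combinatorial games under normal play; $G=H$ means equal game value (equivalently $G-H$ is a second-player win). A strong placement game (SP-game) is a combinatorial game such that: (i) the board is empty at the beginning; (ii) players place pieces on empty vertices of the board according to the rules; (iii) pieces are never moved or removed; (iv) if a position can be reached through some sequence of legal moves, then any sequence of moves leading to it consists of legal moves. Games representing numbers: $0=\{\,\mid\,\}$, $n=\{n-1\mid\,\}$ and $-n=\{\,\mid -(n-1)\}$ for integers $n>0$, $\frac{1}{2^n}=\{0\mid\frac{1}{2^{n-1}}\}$, and other dyadic rationals are (disjunctive) sums of these games and their negatives. -}

module Defs where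

open import Data.Nat using (ℕ; zero; suc; _+_)
open import Data.Integer using (ℤ; +_; -[1+_])
open import Data.Fin using (Fin; splitAt; _≟_)
open import Data.Sum using ([_,_]′)
open import Data.Product using (_×_; Σ)
open import Data.Bool using (Bool; true; false; T; if_then_else_)
open import Data.List using (List; length; filter; allFin; lookup)
open import Relation.Nullary using (¬_; Dec; does)
open import Relation.Nullary.Decidable using (_×-dec_; T?)
open import Relation.Binary.PropositionalEquality using (_≡_)
open import Data.Sum using (_⊎_)

data Game : Set where
  mk : (l r : ℕ) → (Fin l → Game) → (Fin r → Game) → Game

_≤G_ : Game → Game → Set
G@(mk _ _ GL _) ≤G H@(mk _ _ _ HR) =
  (∀ i → ¬ (H ≤G GL i)) × (∀ j → ¬ (HR j ≤G G))

_=G_ : Game → Game → Set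
G =G H = (G ≤G H) × (H ≤G G)

negG : Game → Game
negG (mk l r GL GR) = mk r l (λ j → negG (GR j)) (λ i → negG (GL i))

_+G_ : Game → Game → Game
G@(mk l r GL GR) +G H@(mk l' r' HL HR) =
  mk (l + l') (r + r')
     (λ k → [ (λ i → GL i +G H) , (λ j → G +G HL j) ]′ (splitAt l k))
     (λ k → [ (λ i → GR i +G H) , (λ j → G +G HR j) ]′ (splitAt r k))

zeroG : Game
zeroG = mk 0 0 (λ ()) (λ ())

halfPow : ℕ → Game
halfPow zero    = mk 1 0 (λ _ → zeroG) (λ ())
halfPow (suc n) = mk 1 1 (λ _ → zeroG) (λ _ → halfPow n)

multG : ℕ → Game → Game
multG zero    G = zeroG
multG (suc k) G = G +G multG k G

dyadic : ℤ → ℕ → Game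
dyadic (+ k)    n = multG k (halfPow n)
dyadic -[1+ k ] n = negG (multG (suc k) (halfPow n))

data Cell : Set where
  empty left right : Cell

isEmpty : Cell → Bool
isEmpty empty = true
isEmpty left  = false
isEmpty right = false

Position : ℕ → Set
Position k = Fin k → Cell

emptyPos : ∀ {k} → Position k
emptyPos _ = empty

_⊑_ : ∀ {k} → Position k → Position k → Set
P ⊑ Q = ∀ v → (P v ≡ empty) ⊎ (P v ≡ Q v)

place : ∀ {k} → Position k → Fin k → Cell → Position k
place P v c w = if does (w ≟ v) then c else P w

-- An SP-game: the rules are given by the (decidable) set of legal
-- positions; the board starts empty, pieces are only placed on empty
-- vertices and never moved/removed, and condition (iv) says exactly that
-- the set of legal positions is closed under removing pieces.
record SPGame : Set₁ where
  field
    size       : ℕ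
    Legal      : Position size → Set
    legal?     : (P : Position size) → Dec (Legal P)
    legalEmpty : Legal emptyPos
    downClosed : (P Q : Position size) → P ⊑ Q → Legal Q → Legal P

module _ (S : SPGame) where
  open SPGame S

  canPlace : Position size → Cell → Fin size → Set
  canPlace P c v = T (isEmpty (P v)) × Legal (place P v c)

  canPlace? : (P : Position size) (c : Cell) (v : Fin size) → Dec (canPlace P c v)
  canPlace? P c v = T? (isEmpty (P v)) ×-dec legal? (place P v c)

  moves : Position size → Cell → List (Fin size)
  moves P c = filter (canPlace? P c) (allFin size)

  -- game tree from position P, with fuel (each move fills an empty
  -- vertex, so fuel = size suffices to represent the whole game)
  tree : ℕ → Position size → Game
  tree zero    P = zeroG
  tree (suc m) P =
    mk (length (moves P left)) (length (moves P right))
       (λ i → tree m (place P (lookup (moves P left) i) left))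
       (λ i → tree m (place P (lookup (moves P right) i) right))

  spValue : Game
  spValue = tree size emptyPos

-- The board for 1/2ⁿ has n vertices for Right and n + 1 for Left. Left may
-- place a single piece, on her a-th vertex only while Right has placed at most
-- a pieces; Right may fill his vertices freely. While Left has not moved and k
-- of Right's vertices are empty, every Left move leads to a position where Left
-- can never move again (value ≤ 0), and she can pick the one where Right cannot
-- move either (value 0); every Right move leads to the same situation with
-- k - 1. So the value is {0 | 1/2^(k-1)} = 1/2^k. Playing on disjoint boards
-- realises sums and swapping the colours of all pieces realises negatives.
--
-- Equalities are obtained through the relation ⊴, which implies ≤ and which a
-- game tree satisfies as soon as its moves can be matched step by step with
-- the options of the other game.

module Submission where

open import Defs
open import Data.Integer using (ℤ; +_; -[1+_])
open import Data.Nat using (ℕ; zero; suc; _+_; _≤_; _<_; z≤n; s≤s; _≤?_)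
open import Data.Nat.Properties
  using (≤-refl; ≤-reflexive; ≤-trans; +-mono-≤; +-suc; suc-injective; ≤-pred; m≤m+n; m≤n+m; n≮n)
open import Data.Fin using (Fin; _≟_; toℕ; fromℕ<; splitAt; _↑ˡ_; _↑ʳ_)
  renaming (zero to fzero; suc to fsuc)
open import Data.Fin.Properties
  using (splitAt-↑ˡ; splitAt-↑ʳ; join-splitAt; ↑ˡ-injective; ↑ʳ-injective; all?; toℕ-fromℕ<)
open import Data.Sum using (_⊎_; inj₁; inj₂; [_,_]′) renaming (map to ⊎-map)
open import Data.Product using (_×_; Σ; _,_; proj₁; proj₂)
open import Data.Empty using (⊥-elim)
open import Data.Unit using (⊤; tt)
open import Data.Bool using (T; if_then_else_)
open import Data.List using (allFin; lookup)
open import Data.List.Membership.Propositional.Properties using (∈-filter⁺; ∈-filter⁻; ∈-allFin; ∈-lookup)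
open import Data.List.Relation.Unary.Any using (index)
open import Data.List.Relation.Unary.Any.Properties using (lookup-index)
open import Function using (_∘_)
open import Relation.Nullary using (¬_; Dec; yes; no; does)
open import Relation.Nullary.Decidable using (map′; ¬?; _×-dec_; _→-dec_)
open import Relation.Binary.Definitions using (DecidableEquality)
open import Relation.Binary.PropositionalEquality

_≟ᶜ_ : DecidableEquality Cell
empty ≟ᶜ empty = yes refl
empty ≟ᶜ left  = no λ ()
empty ≟ᶜ right = no λ ()
left  ≟ᶜ empty = no λ ()
left  ≟ᶜ left  = yes refl
left  ≟ᶜ right = no λ ()
right ≟ᶜ empty = no λ ()
right ≟ᶜ left  = no λ ()
right ≟ᶜ right = yes refl

T-isEmpty⇒≡empty : ∀ {c} → T (isEmpty c) → c ≡ empty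
T-isEmpty⇒≡empty {empty} _ = refl

≡empty⇒T-isEmpty : ∀ {c} → c ≡ empty → T (isEmpty c)
≡empty⇒T-isEmpty refl = _

≢left-≢right⇒≡empty : ∀ {c} → c ≢ left → c ≢ right → c ≡ empty
≢left-≢right⇒≡empty {empty} _ _ = refl
≢left-≢right⇒≡empty {left}  ≢left _ = ⊥-elim (≢left refl)
≢left-≢right⇒≡empty {right} _ ≢right = ⊥-elim (≢right refl)

left≢empty : left ≢ empty
left≢empty ()

right≢empty : right ≢ empty
right≢empty ()

indicator : Cell → Cell → ℕ
indicator d c = if does (d ≟ᶜ c) then 1 else 0

count : Cell → ∀ {k} → Position k → ℕ
count c {zero}  P = 0
count c {suc k} P = indicator (P fzero) c + count c (P ∘ fsuc)

module _ {c : Cell} where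

  indicator-≡ : indicator c c ≡ 1
  indicator-≡ with c ≟ᶜ c
  ... | yes _ = refl
  ... | no c≢c = ⊥-elim (c≢c refl)

  indicator-≢ : ∀ {d} → d ≢ c → indicator d c ≡ 0
  indicator-≢ {d} d≢c with d ≟ᶜ c
  ... | yes d≡c = ⊥-elim (d≢c d≡c)
  ... | no _ = refl

  indicator-≤1 : ∀ d → indicator d c ≤ 1
  indicator-≤1 d with d ≟ᶜ c
  ... | yes _ = s≤s z≤n
  ... | no _ = z≤n

  indicator-mono : ∀ {d e} → (d ≡ c → e ≡ c) → indicator d c ≤ indicator e c
  indicator-mono {d} {e} d⇒e with d ≟ᶜ c | e ≟ᶜ c
  ... | yes _   | yes _ = ≤-refl
  ... | no _    | _     = z≤n
  ... | yes d≡c | no e≢c = ⊥-elim (e≢c (d⇒e d≡c))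

  count-cong : ∀ {k} {P Q : Position k} → P ≗ Q → count c P ≡ count c Q
  count-cong {zero}  P≗Q = refl
  count-cong {suc k} P≗Q = cong₂ _+_ (cong (λ d → indicator d c) (P≗Q fzero)) (count-cong (P≗Q ∘ fsuc))

  count-mono : ∀ {k} {P Q : Position k} → (∀ v → P v ≡ c → Q v ≡ c) → count c P ≤ count c Q
  count-mono {zero}  P⇒Q = z≤n
  count-mono {suc k} P⇒Q = +-mono-≤ (indicator-mono (P⇒Q fzero)) (count-mono (P⇒Q ∘ fsuc))

  count-≤-size : ∀ {k} (P : Position k) → count c P ≤ k
  count-≤-size {zero}  P = z≤n
  count-≤-size {suc k} P = +-mono-≤ (indicator-≤1 (P fzero)) (count-≤-size (P ∘ fsuc))

  count-const : ∀ {k} {P : Position k} → (∀ v → P v ≡ c) → count c P ≡ k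
  count-const {zero}  P≡c = refl
  count-const {suc k} P≡c rewrite P≡c fzero | indicator-≡ = cong suc (count-const (P≡c ∘ fsuc))

  count-place-≡ : ∀ {k} (P : Position k) v → P v ≢ c → count c (place P v c) ≡ suc (count c P)
  count-place-≡ P fzero    Pv≢c rewrite indicator-≡ | indicator-≢ Pv≢c = refl
  count-place-≡ P (fsuc v) Pv≢c =
    trans (cong (_+_ (indicator (P fzero) c)) (count-place-≡ (P ∘ fsuc) v Pv≢c)) (+-suc _ _)

  count-place-≢ : ∀ {k} (P : Position k) v {d} → P v ≡ c → d ≢ c → suc (count c (place P v d)) ≡ count c P
  count-place-≢ P fzero    Pv≡c d≢c rewrite Pv≡c | indicator-≡ | indicator-≢ d≢c = refl
  count-place-≢ P (fsuc v) Pv≡c d≢c =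
    trans (sym (+-suc _ _)) (cong (_+_ (indicator (P fzero) c)) (count-place-≢ (P ∘ fsuc) v Pv≡c d≢c))

  count-suc⇒∃ : ∀ {k} (P : Position k) {n} → count c P ≡ suc n → Σ (Fin k) λ v → P v ≡ c
  count-suc⇒∃ {zero}  P ()
  count-suc⇒∃ {suc k} P eq with P fzero ≟ᶜ c
  ... | yes P0≡c = fzero , P0≡c
  ... | no _ = let v , Pv≡c = count-suc⇒∃ (P ∘ fsuc) eq in fsuc v , Pv≡c

place-≡ : ∀ {k} (P : Position k) v c → place P v c v ≡ c
place-≡ P v c with v ≟ v
... | yes _ = refl
... | no v≢v = ⊥-elim (v≢v refl)

place-≢ : ∀ {k} (P : Position k) {v} c {w} → w ≢ v → place P v c w ≡ P w
place-≢ P {v} c {w} w≢v with w ≟ v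
... | yes w≡v = ⊥-elim (w≢v w≡v)
... | no _ = refl

place-cong : ∀ {k} {P Q : Position k} v c → P ≗ Q → place P v c ≗ place Q v c
place-cong v c P≗Q w with w ≟ v
... | yes _ = refl
... | no _ = P≗Q w

place-≢-cell : ∀ {k} (P : Position k) v {c d} w → place P v c w ≡ d → c ≢ d → P w ≡ d
place-≢-cell P v w eq c≢d with w ≟ v
... | yes _ = ⊥-elim (c≢d eq)
... | no _ = eq

place-∘-injective : ∀ {a b} (f : Fin a → Fin b) → (∀ {x y} → f x ≡ f y → x ≡ y) →
                    ∀ (P : Position b) x c → place P (f x) c ∘ f ≗ place (P ∘ f) x c
place-∘-injective f f-inj P x c w with f w ≟ f x | w ≟ x
... | yes _      | yes _    = refl
... | no _       | no _     = refl
... | yes fw≡fx  | no w≢x   = ⊥-elim (w≢x (f-inj fw≡fx))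
... | no fw≢fx   | yes w≡x  = ⊥-elim (fw≢fx (cong f w≡x))

place-∘-outside : ∀ {a b} (f : Fin a → Fin b) (P : Position b) {v} c → (∀ w → f w ≢ v) →
                  place P v c ∘ f ≗ P ∘ f
place-∘-outside f P c f≢v w = place-≢ P c (f≢v w)

↑ˡ≢↑ʳ : ∀ {m n} (i : Fin m) (j : Fin n) → i ↑ˡ n ≢ m ↑ʳ j
↑ˡ≢↑ʳ {m} {n} i j eq with trans (sym (splitAt-↑ˡ m i n)) (trans (cong (splitAt m) eq) (splitAt-↑ʳ m n j))
... | ()

↑ˡ-↑ʳ-cases : ∀ m {n} (v : Fin (m + n)) → (Σ _ λ i → v ≡ i ↑ˡ n) ⊎ (Σ _ λ j → v ≡ m ↑ʳ j)
↑ˡ-↑ʳ-cases m {n} v with splitAt m v | join-splitAt m n v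
... | inj₁ i | join≡v = inj₁ (i , sym join≡v)
... | inj₂ j | join≡v = inj₂ (j , sym join≡v)

⊑-preserves-piece : ∀ {k} {P Q : Position k} → P ⊑ Q → ∀ {c} v → c ≢ empty → P v ≡ c → Q v ≡ c
⊑-preserves-piece P⊑Q v c≢empty Pv≡c with P⊑Q v
... | inj₁ Pv≡empty = ⊥-elim (c≢empty (trans (sym Pv≡c) Pv≡empty))
... | inj₂ Pv≡Qv = trans (sym Pv≡Qv) Pv≡c

data Side : Set where
  L R : Side

numOptions : Side → Game → ℕ
numOptions L (mk l _ _ _) = l
numOptions R (mk _ r _ _) = r

option : (s : Side) (G : Game) → Fin (numOptions s G) → Game
option L (mk _ _ GL _) = GL
option R (mk _ _ _ GR) = GR

piece : Side → Cell
piece L = left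
piece R = right

piece≢empty : ∀ s → piece s ≢ empty
piece≢empty L ()
piece≢empty R ()

-- Unlike _≤G_, this only asks for matching options, so it can be
-- established by simulating play.
_⊴_ : Game → Game → Set
mk _ _ GL GR ⊴ mk _ _ HL HR =
  (∀ i → Σ _ λ j → GL i ⊴ HL j) × (∀ j → Σ _ λ i → GR i ⊴ HR j)

_≃_ : Game → Game → Set
G ≃ H = G ⊴ H × H ⊴ G

⊴-refl : ∀ G → G ⊴ G
⊴-refl (mk _ _ GL GR) = (λ i → i , ⊴-refl (GL i)) , (λ j → j , ⊴-refl (GR j))

⊴-trans : ∀ {G H K} → G ⊴ H → H ⊴ K → G ⊴ K
⊴-trans {mk _ _ _ _} {mk _ _ _ _} {mk _ _ _ _} (GL⊴HL , HR⊴GR) (HL⊴KL , KR⊴HR) =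
  (λ i → let j , p = GL⊴HL i ; k , q = HL⊴KL j in k , ⊴-trans p q) ,
  (λ k → let j , q = KR⊴HR k ; i , p = HR⊴GR j in i , ⊴-trans p q)

≃-trans : ∀ {G H K} → G ≃ H → H ≃ K → G ≃ K
≃-trans (G⊴H , H⊴G) (H⊴K , K⊴H) = ⊴-trans G⊴H H⊴K , ⊴-trans K⊴H H⊴G

≤G-refl : ∀ G → G ≤G G
≤G-refl G@(mk _ _ GL GR) =
  (λ i G≤GLi → proj₁ (unfold G (GL i) G≤GLi) i (≤G-refl (GL i))) ,
  (λ j GRj≤G → proj₂ (unfold (GR j) G GRj≤G) j (≤G-refl (GR j)))
  where
  unfold : ∀ H K → H ≤G K → (∀ i → ¬ (K ≤G option L H i)) × (∀ j → ¬ (option R K j ≤G H))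
  unfold (mk _ _ _ _) (mk _ _ _ _) H≤K = H≤K

mutual
  ≤G-⊴-trans : ∀ {K X Y} → K ≤G X → X ⊴ Y → K ≤G Y
  ≤G-⊴-trans {mk _ _ _ _} {mk _ _ _ _} {mk _ _ _ _} (p , q) (a , b) =
    (λ i Y≤KLi → p i (⊴-≤G-trans (a , b) Y≤KLi)) ,
    (λ j YRj≤K → let j′ , s = b j in q j′ (⊴-≤G-trans s YRj≤K))

  ⊴-≤G-trans : ∀ {X Y Z} → X ⊴ Y → Y ≤G Z → X ≤G Z
  ⊴-≤G-trans {mk _ _ _ _} {mk _ _ _ _} {mk _ _ _ _} (a , b) (p , q) =
    (λ i Z≤XLi → let j , s = a i in p j (≤G-⊴-trans Z≤XLi s)) ,
    (λ j ZRj≤X → q j (≤G-⊴-trans ZRj≤X (a , b)))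

⊴⇒≤G : ∀ {G H} → G ⊴ H → G ≤G H
⊴⇒≤G {H = H} G⊴H = ⊴-≤G-trans G⊴H (≤G-refl H)

≃⇒=G : ∀ {G H} → G ≃ H → G =G H
≃⇒=G (G⊴H , H⊴G) = ⊴⇒≤G G⊴H , ⊴⇒≤G H⊴G

negG-⊴ : ∀ {G H} → G ⊴ H → negG H ⊴ negG G
negG-⊴ {mk _ _ _ _} {mk _ _ _ _} (GL⊴HL , HR⊴GR) =
  (λ j → let i , p = HR⊴GR j in i , negG-⊴ p) ,
  (λ i → let j , p = GL⊴HL i in j , negG-⊴ p)

negG-≃ : ∀ {G H} → G ≃ H → negG G ≃ negG H
negG-≃ (G⊴H , H⊴G) = negG-⊴ H⊴G , negG-⊴ G⊴H

splitAt-match : (_∼_ : Game → Game → Set) {l l′ m m′ : ℕ}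
  {F : Fin l → Game} {F′ : Fin l′ → Game} {H : Fin m → Game} {H′ : Fin m′ → Game} →
  (∀ i → Σ _ λ i′ → F i ∼ F′ i′) → (∀ j → Σ _ λ j′ → H j ∼ H′ j′) →
  ∀ k → Σ _ λ k′ → [ F , H ]′ (splitAt l k) ∼ [ F′ , H′ ]′ (splitAt l′ k′)
splitAt-match _∼_ {l} {l′} {m} {m′} {F} {F′} {H} {H′} F∼F′ H∼H′ k with splitAt l k
... | inj₁ i = let i′ , p = F∼F′ i in
  i′ ↑ˡ m′ , subst (λ z → F i ∼ [ F′ , H′ ]′ z) (sym (splitAt-↑ˡ l′ i′ m′)) p
... | inj₂ j = let j′ , p = H∼H′ j in
  l′ ↑ʳ j′ , subst (λ z → H j ∼ [ F′ , H′ ]′ z) (sym (splitAt-↑ʳ l′ m′ j′)) p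

+G-⊴ : ∀ {G G′ H H′} → G ⊴ H → G′ ⊴ H′ → (G +G G′) ⊴ (H +G H′)
+G-⊴ {mk _ _ _ _} {mk _ _ _ _} {mk _ _ _ _} {mk _ _ _ _} G⊴H@(GL⊴HL , HR⊴GR) G′⊴H′@(G′L⊴H′L , H′R⊴G′R) =
  splitAt-match _⊴_ (λ i → let i′ , p = GL⊴HL i in i′ , +G-⊴ p G′⊴H′)
                    (λ j → let j′ , p = G′L⊴H′L j in j′ , +G-⊴ G⊴H p) ,
  splitAt-match (λ X Y → Y ⊴ X) (λ i → let i′ , p = HR⊴GR i in i′ , +G-⊴ p G′⊴H′)
                                (λ j → let j′ , p = H′R⊴G′R j in j′ , +G-⊴ G⊴H p)

+G-≃ : ∀ {G G′ H H′} → G ≃ H → G′ ≃ H′ → (G +G G′) ≃ (H +G H′)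
+G-≃ (G⊴H , H⊴G) (G′⊴H′ , H′⊴G′) = +G-⊴ G⊴H G′⊴H′ , +G-⊴ H⊴G H′⊴G′

+G-option₁ : ∀ s G H i → Σ _ λ k → option s (G +G H) k ≡ option s G i +G H
+G-option₁ L (mk l _ _ _) (mk l′ _ _ _) i = i ↑ˡ l′ , cong [ _ , _ ]′ (splitAt-↑ˡ l i l′)
+G-option₁ R (mk _ r _ _) (mk _ r′ _ _) i = i ↑ˡ r′ , cong [ _ , _ ]′ (splitAt-↑ˡ r i r′)

+G-option₂ : ∀ s G H j → Σ _ λ k → option s (G +G H) k ≡ G +G option s H j
+G-option₂ L (mk l _ _ _) (mk l′ _ _ _) j = l ↑ʳ j , cong [ _ , _ ]′ (splitAt-↑ʳ l l′ j)
+G-option₂ R (mk _ r _ _) (mk _ r′ _ _) j = r ↑ʳ j , cong [ _ , _ ]′ (splitAt-↑ʳ r r′ j)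

+G-option⁻ : ∀ s G H k →
  (Σ _ λ i → option s (G +G H) k ≡ option s G i +G H) ⊎ (Σ _ λ j → option s (G +G H) k ≡ G +G option s H j)
+G-option⁻ L (mk l _ _ _) (mk _ _ _ _) k with splitAt l k
... | inj₁ i = inj₁ (i , refl)
... | inj₂ j = inj₂ (j , refl)
+G-option⁻ R (mk _ r _ _) (mk _ _ _ _) k with splitAt r k
... | inj₁ i = inj₁ (i , refl)
... | inj₂ j = inj₂ (j , refl)

module _ (S : SPGame) where
  open SPGame S

  Legal-cong : ∀ {P Q} → P ≗ Q → Legal Q → Legal P
  Legal-cong {P} {Q} P≗Q = downClosed P Q (inj₂ ∘ P≗Q)

  canPlace-lookup : ∀ P c i → canPlace S P c (lookup (moves S P c) i)
  canPlace-lookup P c i = proj₂ (∈-filter⁻ (canPlace? S P c) {xs = allFin size} (∈-lookup i))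

  canPlace⇒index : ∀ {P c v} → canPlace S P c v → Σ _ λ i → lookup (moves S P c) i ≡ v
  canPlace⇒index {P} {c} {v} can =
    let v∈moves = ∈-filter⁺ (canPlace? S P c) (∈-allFin v) can in index v∈moves , sym (lookup-index v∈moves)

  -- P ∼[ m ] Y: position P, with fuel m left, is claimed to be worth Y.
  module Simulation (_∼[_]_ : Position size → ℕ → Game → Set) where

    MovesAnswered : Side → Set
    MovesAnswered s = ∀ {m P Y} → P ∼[ suc m ] Y → ∀ v → canPlace S P (piece s) v →
                      Σ _ λ k → place P v (piece s) ∼[ m ] option s Y k

    OptionsRealised : Side → Set
    OptionsRealised s = ∀ {m P Y} → P ∼[ suc m ] Y → ∀ k →
                        Σ _ λ v → canPlace S P (piece s) v × place P v (piece s) ∼[ m ] option s Y k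

    NoOptionsWithoutFuel : Side → Set
    NoOptionsWithoutFuel s = ∀ {P Y} → P ∼[ 0 ] Y → ¬ Fin (numOptions s Y)

    tree-⊴ : NoOptionsWithoutFuel R → MovesAnswered L → OptionsRealised R →
             ∀ {m P Y} → P ∼[ m ] Y → tree S m P ⊴ Y
    tree-⊴ noR answerL realiseR {zero} {P} {mk _ _ _ _} P∼Y = (λ ()) , ⊥-elim ∘ noR P∼Y
    tree-⊴ noR answerL realiseR {suc m} {P} {mk _ _ _ YR} P∼Y =
      (λ i → let k , next = answerL P∼Y _ (canPlace-lookup P left i) in
             k , tree-⊴ noR answerL realiseR next) ,
      (λ k → let v , can , next = realiseR P∼Y k ; i , lookup≡v = canPlace⇒index can in
             i , tree-⊴ noR answerL realiseR
                   (subst (λ w → place P w right ∼[ m ] YR k) (sym lookup≡v) next))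

    ⊴-tree : NoOptionsWithoutFuel L → OptionsRealised L → MovesAnswered R →
             ∀ {m P Y} → P ∼[ m ] Y → Y ⊴ tree S m P
    ⊴-tree noL realiseL answerR {zero} {P} {mk _ _ _ _} P∼Y = ⊥-elim ∘ noL P∼Y , (λ ())
    ⊴-tree noL realiseL answerR {suc m} {P} {mk _ _ YL _} P∼Y =
      (λ k → let v , can , next = realiseL P∼Y k ; i , lookup≡v = canPlace⇒index can in
             i , ⊴-tree noL realiseL answerR
                   (subst (λ w → place P w left ∼[ m ] YL k) (sym lookup≡v) next)) ,
      (λ j → let k , next = answerR P∼Y _ (canPlace-lookup P right j) in
             k , ⊴-tree noL realiseL answerR next)

    tree-≃ : (∀ s → NoOptionsWithoutFuel s) → (∀ s → MovesAnswered s) → (∀ s → OptionsRealised s) →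
             ∀ {m P Y} → P ∼[ m ] Y → tree S m P ≃ Y
    tree-≃ noOptions answer realise P∼Y =
      tree-⊴ (noOptions R) (answer L) (realise R) P∼Y , ⊴-tree (noOptions L) (realise L) (answer R) P∼Y

  tree-option : ∀ s {m P v} → canPlace S P (piece s) v →
                Σ _ λ k → option s (tree S (suc m) P) k ≡ tree S m (place P v (piece s))
  tree-option L {m} {P} can =
    let i , lookup≡v = canPlace⇒index can in i , cong (λ w → tree S m (place P w left)) lookup≡v
  tree-option R {m} {P} can =
    let i , lookup≡v = canPlace⇒index can in i , cong (λ w → tree S m (place P w right)) lookup≡v

  tree-option⁻ : ∀ s {m P} k →
                 Σ _ λ v → canPlace S P (piece s) v × option s (tree S (suc m) P) k ≡ tree S m (place P v (piece s))
  tree-option⁻ L {P = P} k = _ , canPlace-lookup P left k , refl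
  tree-option⁻ R {P = P} k = _ , canPlace-lookup P right k , refl

module HalfPowGame (n : ℕ) where

  boardSize : ℕ
  boardSize = n + suc n

  rightVertex : Fin n → Fin boardSize
  rightVertex i = i ↑ˡ suc n

  leftVertex : Fin (suc n) → Fin boardSize
  leftVertex a = n ↑ʳ a

  rightPart : Position boardSize → Position n
  rightPart P = P ∘ rightVertex

  record Legal (P : Position boardSize) : Set where
    constructor legal
    field
      rightVertex≢left : ∀ i → P (rightVertex i) ≢ left
      leftVertex≢right : ∀ a → P (leftVertex a) ≢ right
      leftOnce         : ∀ a b → P (leftVertex a) ≡ left → P (leftVertex b) ≡ left → a ≡ b
      leftInTime       : ∀ a → P (leftVertex a) ≡ left → count right (rightPart P) ≤ toℕ a
  open Legal

  Legal? : ∀ P → Dec (Legal P)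
  Legal? P =
    map′ (λ (p , q , r , s) → legal p q r s)
         (λ l → rightVertex≢left l , leftVertex≢right l , leftOnce l , leftInTime l)
    (all? (λ i → ¬? (P (rightVertex i) ≟ᶜ left))
     ×-dec all? (λ a → ¬? (P (leftVertex a) ≟ᶜ right))
     ×-dec all? (λ a → all? λ b → (P (leftVertex a) ≟ᶜ left) →-dec ((P (leftVertex b) ≟ᶜ left) →-dec (a ≟ b)))
     ×-dec all? (λ a → (P (leftVertex a) ≟ᶜ left) →-dec (count right (rightPart P) ≤? toℕ a)))

  Legal-downClosed : ∀ P Q → P ⊑ Q → Legal Q → Legal P
  Legal-downClosed P Q P⊑Q lQ = legal
    (λ i → rightVertex≢left lQ i ∘ keepsLeft)
    (λ a → leftVertex≢right lQ a ∘ ⊑-preserves-piece P⊑Q _ right≢empty)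
    (λ a b Pa Pb → leftOnce lQ a b (keepsLeft Pa) (keepsLeft Pb))
    (λ a Pa → ≤-trans (count-mono (λ i → ⊑-preserves-piece P⊑Q (rightVertex i) right≢empty))
                      (leftInTime lQ a (keepsLeft Pa)))
    where
    keepsLeft : ∀ {v} → P v ≡ left → Q v ≡ left
    keepsLeft = ⊑-preserves-piece P⊑Q _ left≢empty

  game : SPGame
  game = record
    { size = boardSize ; Legal = Legal ; legal? = Legal?
    ; legalEmpty = legal (λ _ ()) (λ _ ()) (λ _ _ ()) (λ _ ())
    ; downClosed = Legal-downClosed }

  LeftPlayed NoLeft : Position boardSize → Set
  LeftPlayed P = Σ _ λ a → P (leftVertex a) ≡ left
  NoLeft P = ∀ a → P (leftVertex a) ≢ left

  leftMove-vertex : ∀ {P v} → canPlace game P left v → Σ _ λ a → v ≡ leftVertex a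
  leftMove-vertex {P} {v} (_ , l) with ↑ˡ-↑ʳ-cases n v
  ... | inj₁ (i , refl) = ⊥-elim (rightVertex≢left l i (place-≡ P (rightVertex i) left))
  ... | inj₂ leftVertex-a = leftVertex-a

  rightMove-vertex : ∀ {P v} → canPlace game P right v → Σ _ λ i → v ≡ rightVertex i
  rightMove-vertex {P} {v} (_ , l) with ↑ˡ-↑ʳ-cases n v
  ... | inj₁ rightVertex-i = rightVertex-i
  ... | inj₂ (a , refl) = ⊥-elim (leftVertex≢right l a (place-≡ P (leftVertex a) right))

  LeftPlayed⇒noLeftMove : ∀ {P v} → LeftPlayed P → ¬ canPlace game P left v
  LeftPlayed⇒noLeftMove {P} (a , Pa≡left) can with leftMove-vertex can
  ... | b , refl with leftVertex a ≟ leftVertex b | can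
  ... | yes a≡b | vacant , _ =
    left≢empty (trans (sym (subst (λ w → P w ≡ left) a≡b Pa≡left)) (T-isEmpty⇒≡empty vacant))
  ... | no a≢b  | _ , l =
    a≢b (cong leftVertex (leftOnce l a b (trans (place-≢ P left a≢b) Pa≡left) (place-≡ P (leftVertex b) left)))

  rightPart-place-right : ∀ P i c → rightPart (place P (rightVertex i) c) ≗ place (rightPart P) i c
  rightPart-place-right P i c = place-∘-injective rightVertex (↑ˡ-injective (suc n) _ _) P i c

  rightPart-place-left : ∀ P a c → rightPart (place P (leftVertex a) c) ≗ rightPart P
  rightPart-place-left P a c = place-∘-outside rightVertex P c (λ i → ↑ˡ≢↑ʳ i a)

  NoLeft-place-right : ∀ {P} i → NoLeft P → NoLeft (place P (rightVertex i) right)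
  NoLeft-place-right {P} i noLeft a Pa≡left = noLeft a (place-≢-cell P (rightVertex i) (leftVertex a) Pa≡left λ ())

  Legal-place-right : ∀ {P} i → Legal P → NoLeft P → Legal (place P (rightVertex i) right)
  Legal-place-right {P} i l noLeft = legal
    (λ j Pj≡left → rightVertex≢left l j (place-≢-cell P (rightVertex i) (rightVertex j) Pj≡left λ ()))
    (λ a → leftVertex≢right l a ∘ trans (sym (place-≢ P right (↑ˡ≢↑ʳ i a ∘ sym))))
    (λ a _ Pa≡left → ⊥-elim (NoLeft-place-right {P} i noLeft a Pa≡left))
    (λ a Pa≡left → ⊥-elim (NoLeft-place-right {P} i noLeft a Pa≡left))

  Legal-place-left : ∀ {P} a → Legal P → NoLeft P → count right (rightPart P) ≤ toℕ a →
                     Legal (place P (leftVertex a) left)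
  Legal-place-left {P} a l noLeft inTime = legal
    (λ i → rightVertex≢left l i ∘ trans (sym (place-≢ P left (↑ˡ≢↑ʳ i a))))
    (λ b → leftVertex≢right l b ∘ λ Pb≡right → place-≢-cell P (leftVertex a) (leftVertex b) Pb≡right λ ())
    (λ b b′ Pb Pb′ → trans (onlyAt-a b Pb) (sym (onlyAt-a b′ Pb′)))
    (λ b Pb → subst (λ x → count right (rightPart (place P (leftVertex a) left)) ≤ toℕ x) (sym (onlyAt-a b Pb))
                (subst (_≤ toℕ a) (sym (count-cong (rightPart-place-left P a left))) inTime))
    where
    onlyAt-a : ∀ b → place P (leftVertex a) left (leftVertex b) ≡ left → b ≡ a
    onlyAt-a b Pb with leftVertex b ≟ leftVertex a
    ... | yes eq = ↑ʳ-injective n b a eq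
    ... | no _ = ⊥-elim (noLeft b Pb)

  record Waiting (P : Position boardSize) (k : ℕ) : Set where
    constructor waiting
    field
      isLegal    : Legal P
      noLeft     : NoLeft P
      emptyRight : count empty (rightPart P) ≡ k
  open Waiting

  Waiting-start : Waiting emptyPos n
  Waiting-start = waiting (SPGame.legalEmpty game) (λ _ ()) (count-const {empty} λ _ → refl)

  Waiting-place-right : ∀ {P k} i → Waiting P k → P (rightVertex i) ≡ empty →
                        Σ _ λ k′ → k ≡ suc k′ × Waiting (place P (rightVertex i) right) k′
  Waiting-place-right {P} i w Pi≡empty =
    count empty (rightPart (place P (rightVertex i) right)) ,
    trans (sym (emptyRight w)) (sym emptiesDrop) ,
    waiting (Legal-place-right i (isLegal w) (noLeft w)) (NoLeft-place-right {P} i (noLeft w)) refl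
    where
    emptiesDrop : suc (count empty (rightPart (place P (rightVertex i) right))) ≡ count empty (rightPart P)
    emptiesDrop = trans (cong suc (count-cong (rightPart-place-right P i right)))
                        (count-place-≢ (rightPart P) i Pi≡empty right≢empty)

  Waiting-rightMove : ∀ {P k} → Waiting P (suc k) → Σ _ λ i → canPlace game P right (rightVertex i)
  Waiting-rightMove {P} w =
    let i , Pi≡empty = count-suc⇒∃ (rightPart P) (emptyRight w) in
    i , ≡empty⇒T-isEmpty Pi≡empty , Legal-place-right i (isLegal w) (noLeft w)

  data Upper (P : Position boardSize) (m : ℕ) : Game → Set where
    leftPlayed : LeftPlayed P → Upper P m zeroG
    waitingFor : ∀ {k} → Waiting P k → k ≤ m → Upper P m (halfPow k)

  module UpperSim = Simulation game Upper

  Upper-noRightOptions : UpperSim.NoOptionsWithoutFuel R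
  Upper-noRightOptions (leftPlayed _) ()
  Upper-noRightOptions (waitingFor {zero} _ _) ()

  leftMove-LeftPlayed : ∀ {P v} → canPlace game P left v → LeftPlayed (place P v left)
  leftMove-LeftPlayed {P} can with leftMove-vertex can
  ... | a , refl = a , place-≡ P (leftVertex a) left

  Upper-leftMoves : UpperSim.MovesAnswered L
  Upper-leftMoves (leftPlayed played)      v can = ⊥-elim (LeftPlayed⇒noLeftMove played can)
  Upper-leftMoves (waitingFor {zero} _ _)  v can = fzero , leftPlayed (leftMove-LeftPlayed can)
  Upper-leftMoves (waitingFor {suc _} _ _) v can = fzero , leftPlayed (leftMove-LeftPlayed can)

  Upper-rightOptions : UpperSim.OptionsRealised R
  Upper-rightOptions (leftPlayed _) ()
  Upper-rightOptions (waitingFor {zero} _ _) ()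
  Upper-rightOptions (waitingFor {suc k} w (s≤s k≤m)) fzero with Waiting-rightMove w
  ... | i , can@(vacant , _) with Waiting-place-right i w (T-isEmpty⇒≡empty vacant)
  ... | _ , refl , w′ = rightVertex i , can , waitingFor w′ k≤m

  data Lower (P : Position boardSize) (m : ℕ) : Game → Set where
    leftSettled : ∀ {a} → P (leftVertex a) ≡ left → count right (rightPart P) ≡ toℕ a → Lower P m zeroG
    waitingFor  : ∀ {k} → Waiting P k → suc k ≤ m → Lower P m (halfPow k)

  module LowerSim = Simulation game Lower

  Lower-noLeftOptions : LowerSim.NoOptionsWithoutFuel L
  Lower-noLeftOptions (leftSettled _ _) ()

  -- Left answers on the vertex indexed by the number of Right pieces,
  -- after which Right can no longer move.
  Lower-leftOptions : LowerSim.OptionsRealised L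
  Lower-leftOptions (leftSettled _ _) ()
  Lower-leftOptions {P = P} (waitingFor {k} w _) i =
    leftVertex a , (≡empty⇒T-isEmpty Pa≡empty , l′) , settled k i
    where
    rights<1+n : count right (rightPart P) < suc n
    rights<1+n = s≤s (count-≤-size (rightPart P))
    a : Fin (suc n)
    a = fromℕ< rights<1+n
    Pa≡empty : P (leftVertex a) ≡ empty
    Pa≡empty = ≢left-≢right⇒≡empty (noLeft w a) (leftVertex≢right (isLegal w) a)
    l′ : Legal (place P (leftVertex a) left)
    l′ = Legal-place-left a (isLegal w) (noLeft w) (≤-reflexive (sym (toℕ-fromℕ< rights<1+n)))
    settled : ∀ k i → Lower (place P (leftVertex a) left) _ (option L (halfPow k) i)
    settled zero fzero = leftSettled (place-≡ P (leftVertex a) left)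
                           (trans (count-cong (rightPart-place-left P a left)) (sym (toℕ-fromℕ< rights<1+n)))
    settled (suc k) fzero = settled zero fzero

  Lower-rightMoves : LowerSim.MovesAnswered R
  Lower-rightMoves {P = P} (leftSettled {a} Pa≡left rights≡a) v can@(vacant , l′) with rightMove-vertex can
  ... | i , refl = ⊥-elim (n≮n (toℕ a) (subst (_≤ toℕ a) rightsAfter (leftInTime l′ a stillLeft)))
    where
    stillLeft : place P (rightVertex i) right (leftVertex a) ≡ left
    stillLeft = trans (place-≢ P right (↑ˡ≢↑ʳ i a ∘ sym)) Pa≡left
    Pi≢right : P (rightVertex i) ≢ right
    Pi≢right Pi≡right = right≢empty (trans (sym Pi≡right) (T-isEmpty⇒≡empty vacant))
    rightsAfter : count right (rightPart (place P (rightVertex i) right)) ≡ suc (toℕ a)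
    rightsAfter = trans (count-cong (rightPart-place-right P i right))
                        (trans (count-place-≡ (rightPart P) i Pi≢right) (cong suc rights≡a))
  Lower-rightMoves (waitingFor w 1+k≤1+m) v can@(vacant , _) with rightMove-vertex can
  ... | i , refl with Waiting-place-right i w (T-isEmpty⇒≡empty vacant)
  ... | _ , refl , w′ = fzero , waitingFor w′ (≤-pred 1+k≤1+m)

  halfPow-value : spValue game ≃ halfPow n
  halfPow-value =
    UpperSim.tree-⊴ Upper-noRightOptions Upper-leftMoves Upper-rightOptions
      (waitingFor Waiting-start (m≤m+n n (suc n))) ,
    LowerSim.⊴-tree Lower-noLeftOptions Lower-leftOptions Lower-rightMoves
      (waitingFor Waiting-start (m≤n+m (suc n) n))

zeroG-noOption : ∀ s → ¬ Fin (numOptions s zeroG)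
zeroG-noOption L ()
zeroG-noOption R ()

-- Positions are functions and tree does not respect _≗_, so a component
-- position is tracked by an equal one; the fuel covers every remaining move.
record Tracks (T : SPGame) (P : Position (SPGame.size T)) (fuel : ℕ) (Q : Position (SPGame.size T)) : Set where
  constructor tracks
  field
    ≗position : Q ≗ P
    enough    : count empty Q ≤ fuel
    isLegal   : SPGame.Legal T Q
open Tracks

module _ {T : SPGame} where
  open SPGame T

  Tracks-cong : ∀ {P P′ f Q} → P ≗ P′ → Tracks T P f Q → Tracks T P′ f Q
  Tracks-cong P≗P′ (tracks Q≗P enough l) = tracks (λ v → trans (Q≗P v) (P≗P′ v)) enough l

  Tracks-place : ∀ {P f Q x c} → Tracks T P f Q → canPlace T Q c x → c ≢ empty →
                 Σ _ λ f′ → f ≡ suc f′ × Tracks T (place P x c) f′ (place Q x c)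
  Tracks-place {P} {suc f} {Q} {x} {c} (tracks Q≗P enough _) (vacant , l) c≢empty =
    f , refl , tracks (place-cong x c Q≗P) (≤-pred (subst (_≤ suc f) (sym fewerEmpties) enough)) l
    where
    fewerEmpties : suc (count empty (place Q x c)) ≡ count empty Q
    fewerEmpties = count-place-≢ Q x (T-isEmpty⇒≡empty vacant) c≢empty
  Tracks-place {f = zero} {Q} {x} {c} (tracks _ enough _) (vacant , _) c≢empty
    with subst (_≤ 0) (sym (count-place-≢ Q x (T-isEmpty⇒≡empty vacant) c≢empty)) enough
  ... | ()

module SumGame (S₁ S₂ : SPGame) where
  module G₁ = SPGame S₁
  module G₂ = SPGame S₂

  boardSize : ℕ
  boardSize = G₁.size + G₂.size

  embed₁ : Fin G₁.size → Fin boardSize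
  embed₁ x = x ↑ˡ G₂.size

  embed₂ : Fin G₂.size → Fin boardSize
  embed₂ y = G₁.size ↑ʳ y

  part₁ : Position boardSize → Position G₁.size
  part₁ P = P ∘ embed₁

  part₂ : Position boardSize → Position G₂.size
  part₂ P = P ∘ embed₂

  Legal : Position boardSize → Set
  Legal P = G₁.Legal (part₁ P) × G₂.Legal (part₂ P)

  game : SPGame
  game = record
    { size = boardSize ; Legal = Legal ; legal? = λ P → G₁.legal? (part₁ P) ×-dec G₂.legal? (part₂ P)
    ; legalEmpty = G₁.legalEmpty , G₂.legalEmpty
    ; downClosed = λ P Q P⊑Q (l₁ , l₂) → G₁.downClosed _ _ (P⊑Q ∘ embed₁) l₁ , G₂.downClosed _ _ (P⊑Q ∘ embed₂) l₂ }

  part₁-place₁ : ∀ P x c → place (part₁ P) x c ≗ part₁ (place P (embed₁ x) c)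
  part₁-place₁ P x c w = sym (place-∘-injective embed₁ (↑ˡ-injective G₂.size _ _) P x c w)

  part₂-place₁ : ∀ P x c → part₂ P ≗ part₂ (place P (embed₁ x) c)
  part₂-place₁ P x c w = sym (place-∘-outside embed₂ P c (λ y → ↑ˡ≢↑ʳ x y ∘ sym) w)

  part₂-place₂ : ∀ P y c → place (part₂ P) y c ≗ part₂ (place P (embed₂ y) c)
  part₂-place₂ P y c w = sym (place-∘-injective embed₂ (↑ʳ-injective G₁.size _ _) P y c w)

  part₁-place₂ : ∀ P y c → part₁ P ≗ part₁ (place P (embed₂ y) c)
  part₁-place₂ P y c w = sym (place-∘-outside embed₁ P c (λ x → ↑ˡ≢↑ʳ x y) w)

  record Split (P : Position boardSize) (m : ℕ) (Y : Game) : Set where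
    constructor split
    field
      {fuel₁ fuel₂} : ℕ
      {Q₁} : Position G₁.size
      {Q₂} : Position G₂.size
      fuel-sum : m ≡ fuel₁ + fuel₂
      tracks₁  : Tracks S₁ (part₁ P) fuel₁ Q₁
      tracks₂  : Tracks S₂ (part₂ P) fuel₂ Q₂
      value    : Y ≡ tree S₁ fuel₁ Q₁ +G tree S₂ fuel₂ Q₂

  canPlace₁⁻ : ∀ {P f Q x c} → Tracks S₁ (part₁ P) f Q → canPlace game P c (embed₁ x) → canPlace S₁ Q c x
  canPlace₁⁻ {P} {x = x} {c} t (vacant , l₁ , _) =
    subst (T ∘ isEmpty) (sym (≗position t x)) vacant ,
    Legal-cong S₁ (λ w → trans (place-cong x c (≗position t) w) (part₁-place₁ P x c w)) l₁

  canPlace₂⁻ : ∀ {P f Q y c} → Tracks S₂ (part₂ P) f Q → canPlace game P c (embed₂ y) → canPlace S₂ Q c y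
  canPlace₂⁻ {P} {y = y} {c} t (vacant , _ , l₂) =
    subst (T ∘ isEmpty) (sym (≗position t y)) vacant ,
    Legal-cong S₂ (λ w → trans (place-cong y c (≗position t) w) (part₂-place₂ P y c w)) l₂

  canPlace₁⁺ : ∀ {P f₁ f₂ Q₁ Q₂ x c} → Tracks S₁ (part₁ P) f₁ Q₁ → Tracks S₂ (part₂ P) f₂ Q₂ →
               canPlace S₁ Q₁ c x → canPlace game P c (embed₁ x)
  canPlace₁⁺ {P} {x = x} {c} t₁ t₂ (vacant , l₁) =
    subst (T ∘ isEmpty) (≗position t₁ x) vacant ,
    Legal-cong S₁ (λ w → sym (trans (place-cong x c (≗position t₁) w) (part₁-place₁ P x c w))) l₁ ,
    Legal-cong S₂ (λ w → sym (trans (≗position t₂ w) (part₂-place₁ P x c w))) (isLegal t₂)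

  canPlace₂⁺ : ∀ {P f₁ f₂ Q₁ Q₂ y c} → Tracks S₁ (part₁ P) f₁ Q₁ → Tracks S₂ (part₂ P) f₂ Q₂ →
               canPlace S₂ Q₂ c y → canPlace game P c (embed₂ y)
  canPlace₂⁺ {P} {y = y} {c} t₁ t₂ (vacant , l₂) =
    subst (T ∘ isEmpty) (≗position t₂ y) vacant ,
    Legal-cong S₁ (λ w → sym (trans (≗position t₁ w) (part₁-place₂ P y c w))) (isLegal t₁) ,
    Legal-cong S₂ (λ w → sym (trans (place-cong y c (≗position t₂) w) (part₂-place₂ P y c w))) l₂

  Split-place₁ : ∀ s {P m f₁ f₂ Q₁ Q₂ x} → suc m ≡ f₁ + f₂ → Tracks S₁ (part₁ P) f₁ Q₁ → Tracks S₂ (part₂ P) f₂ Q₂ →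
                 canPlace S₁ Q₁ (piece s) x →
                 Σ _ λ f₁′ → f₁ ≡ suc f₁′ ×
                   Split (place P (embed₁ x) (piece s)) m (tree S₁ f₁′ (place Q₁ x (piece s)) +G tree S₂ f₂ Q₂)
  Split-place₁ s {P} {x = x} fuel-sum t₁ t₂ can with Tracks-place t₁ can (piece≢empty s)
  ... | f₁′ , refl , t₁′ =
    f₁′ , refl ,
    split (suc-injective fuel-sum) (Tracks-cong (part₁-place₁ P x (piece s)) t₁′)
          (Tracks-cong (part₂-place₁ P x (piece s)) t₂) refl

  Split-place₂ : ∀ s {P m f₁ f₂ Q₁ Q₂ y} → suc m ≡ f₁ + f₂ → Tracks S₁ (part₁ P) f₁ Q₁ → Tracks S₂ (part₂ P) f₂ Q₂ →
                 canPlace S₂ Q₂ (piece s) y →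
                 Σ _ λ f₂′ → f₂ ≡ suc f₂′ ×
                   Split (place P (embed₂ y) (piece s)) m (tree S₁ f₁ Q₁ +G tree S₂ f₂′ (place Q₂ y (piece s)))
  Split-place₂ s {P} {f₁ = f₁} {y = y} fuel-sum t₁ t₂ can with Tracks-place t₂ can (piece≢empty s)
  ... | f₂′ , refl , t₂′ =
    f₂′ , refl ,
    split (suc-injective (trans fuel-sum (+-suc f₁ f₂′))) (Tracks-cong (part₁-place₂ P y (piece s)) t₁)
          (Tracks-cong (part₂-place₂ P y (piece s)) t₂′) refl

  module Sim = Simulation game Split

  Split-noOptionsWithoutFuel : ∀ s → Sim.NoOptionsWithoutFuel s
  Split-noOptionsWithoutFuel L (split {zero} {zero} refl _ _ refl) ()
  Split-noOptionsWithoutFuel R (split {zero} {zero} refl _ _ refl) ()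

  Split-movesAnswered : ∀ s → Sim.MovesAnswered s
  Split-movesAnswered s {P = P} (split fuel-sum t₁ t₂ refl) v can with ↑ˡ-↑ʳ-cases G₁.size v
  ... | inj₁ (x , refl) with Split-place₁ s fuel-sum t₁ t₂ (canPlace₁⁻ {P} t₁ can)
  ...   | _ , refl , sp =
    let i , optionᵢ≡ = tree-option S₁ s (canPlace₁⁻ {P} t₁ can) ; k , optionₖ≡ = +G-option₁ s _ _ i in
    k , subst (Split _ _) (sym (trans optionₖ≡ (cong (_+G _) optionᵢ≡))) sp
  Split-movesAnswered s {P = P} (split fuel-sum t₁ t₂ refl) v can | inj₂ (y , refl)
    with Split-place₂ s fuel-sum t₁ t₂ (canPlace₂⁻ {P} t₂ can)
  ...   | _ , refl , sp =
    let j , optionⱼ≡ = tree-option S₂ s (canPlace₂⁻ {P} t₂ can) ; k , optionₖ≡ = +G-option₂ s _ _ j in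
    k , subst (Split _ _) (sym (trans optionₖ≡ (cong (_ +G_) optionⱼ≡))) sp

  Split-realise₁ : ∀ s {P m f₁ f₂ Q₁ Q₂} → suc m ≡ f₁ + f₂ → Tracks S₁ (part₁ P) f₁ Q₁ → Tracks S₂ (part₂ P) f₂ Q₂ →
             ∀ i → Σ _ λ x → canPlace game P (piece s) (embed₁ x) ×
                   Split (place P (embed₁ x) (piece s)) m (option s (tree S₁ f₁ Q₁) i +G tree S₂ f₂ Q₂)
  Split-realise₁ s {f₁ = zero} _ _ _ i = ⊥-elim (zeroG-noOption s i)
  Split-realise₁ s {P} {f₁ = suc _} fuel-sum t₁ t₂ i with tree-option⁻ S₁ s i
  ... | x , can , optionᵢ≡ with Split-place₁ s {P} fuel-sum t₁ t₂ can
  ... | _ , refl , sp = x , canPlace₁⁺ {P} t₁ t₂ can , subst (λ G → Split _ _ (G +G _)) (sym optionᵢ≡) sp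

  Split-realise₂ : ∀ s {P m f₁ f₂ Q₁ Q₂} → suc m ≡ f₁ + f₂ → Tracks S₁ (part₁ P) f₁ Q₁ → Tracks S₂ (part₂ P) f₂ Q₂ →
             ∀ j → Σ _ λ y → canPlace game P (piece s) (embed₂ y) ×
                   Split (place P (embed₂ y) (piece s)) m (tree S₁ f₁ Q₁ +G option s (tree S₂ f₂ Q₂) j)
  Split-realise₂ s {f₂ = zero} _ _ _ j = ⊥-elim (zeroG-noOption s j)
  Split-realise₂ s {P} {f₂ = suc _} fuel-sum t₁ t₂ j with tree-option⁻ S₂ s j
  ... | y , can , optionⱼ≡ with Split-place₂ s {P} fuel-sum t₁ t₂ can
  ... | _ , refl , sp = y , canPlace₂⁺ {P} t₁ t₂ can , subst (λ G → Split _ _ (_ +G G)) (sym optionⱼ≡) sp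

  Split-optionsRealised : ∀ s → Sim.OptionsRealised s
  Split-optionsRealised s (split fuel-sum t₁ t₂ refl) k with +G-option⁻ s _ _ k
  ... | inj₁ (i , optionₖ≡) =
    let x , can , sp = Split-realise₁ s fuel-sum t₁ t₂ i in embed₁ x , can , subst (Split _ _) (sym optionₖ≡) sp
  ... | inj₂ (j , optionₖ≡) =
    let y , can , sp = Split-realise₂ s fuel-sum t₁ t₂ j in embed₂ y , can , subst (Split _ _) (sym optionₖ≡) sp

  sum-value : spValue game ≃ (spValue S₁ +G spValue S₂)
  sum-value = Sim.tree-≃ Split-noOptionsWithoutFuel Split-movesAnswered Split-optionsRealised
    (split refl (tracks (λ _ → refl) (count-≤-size _) G₁.legalEmpty)
                (tracks (λ _ → refl) (count-≤-size _) G₂.legalEmpty) refl)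

swap : Cell → Cell
swap empty = empty
swap left  = right
swap right = left

swap-empty : ∀ {c} → c ≡ empty → swap c ≡ empty
swap-empty refl = refl

swap-empty⁻ : ∀ {c} → swap c ≡ empty → c ≡ empty
swap-empty⁻ {empty} _ = refl

module SwapGame (S : SPGame) where
  open SPGame S using (size; Legal; legal?; legalEmpty; downClosed)

  game : SPGame
  game = record
    { size = size ; Legal = λ P → Legal (swap ∘ P) ; legal? = λ P → legal? (swap ∘ P) ; legalEmpty = legalEmpty
    ; downClosed = λ P Q P⊑Q → downClosed _ _ (⊎-map swap-empty (cong swap) ∘ P⊑Q) }

  module _ {P Q : Position size} (Q≗swapP : Q ≗ swap ∘ P) where

    place-swap : ∀ v c → place Q v (swap c) ≗ swap ∘ place P v c
    place-swap v c w with w ≟ v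
    ... | yes _ = refl
    ... | no _ = Q≗swapP w

    canPlace-swap : ∀ {v c} → canPlace game P c v → canPlace S Q (swap c) v
    canPlace-swap {v} {c} (vacant , l) =
      ≡empty⇒T-isEmpty (trans (Q≗swapP v) (swap-empty (T-isEmpty⇒≡empty vacant))) , Legal-cong S (place-swap v c) l

    canPlace-swap⁻ : ∀ {v c} → canPlace S Q (swap c) v → canPlace game P c v
    canPlace-swap⁻ {v} {c} (vacant , l) =
      ≡empty⇒T-isEmpty (swap-empty⁻ (trans (sym (Q≗swapP v)) (T-isEmpty⇒≡empty vacant))) ,
      Legal-cong S (sym ∘ place-swap v c) l

  record Swapped (P : Position size) (m : ℕ) (Y : Game) : Set where
    constructor swapped
    field
      {Q}     : Position size
      Q≗swapP : Q ≗ swap ∘ P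
      value   : Y ≡ negG (tree S m Q)

  module Sim = Simulation game Swapped

  Swapped-noOptionsWithoutFuel : ∀ s → Sim.NoOptionsWithoutFuel s
  Swapped-noOptionsWithoutFuel L (swapped _ refl) ()
  Swapped-noOptionsWithoutFuel R (swapped _ refl) ()

  Swapped-movesAnswered : ∀ s → Sim.MovesAnswered s
  Swapped-movesAnswered L (swapped Q≗swapP refl) v can =
    let i , optionᵢ≡ = tree-option S R (canPlace-swap Q≗swapP can) in
    i , swapped (place-swap Q≗swapP v left) (cong negG optionᵢ≡)
  Swapped-movesAnswered R (swapped Q≗swapP refl) v can =
    let i , optionᵢ≡ = tree-option S L (canPlace-swap Q≗swapP can) in
    i , swapped (place-swap Q≗swapP v right) (cong negG optionᵢ≡)

  Swapped-optionsRealised : ∀ s → Sim.OptionsRealised s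
  Swapped-optionsRealised L (swapped Q≗swapP refl) k =
    let v , can , optionₖ≡ = tree-option⁻ S R k in
    v , canPlace-swap⁻ Q≗swapP can , swapped (place-swap Q≗swapP v left) (cong negG optionₖ≡)
  Swapped-optionsRealised R (swapped Q≗swapP refl) k =
    let v , can , optionₖ≡ = tree-option⁻ S L k in
    v , canPlace-swap⁻ Q≗swapP can , swapped (place-swap Q≗swapP v right) (cong negG optionₖ≡)

  negG-value : spValue game ≃ negG (spValue S)
  negG-value = Sim.tree-≃ Swapped-noOptionsWithoutFuel Swapped-movesAnswered Swapped-optionsRealised
                 (swapped (λ _ → refl) refl)

emptyBoard : SPGame
emptyBoard = record
  { size = 0 ; Legal = λ _ → ⊤ ; legal? = λ _ → yes tt ; legalEmpty = tt ; downClosed = λ _ _ _ _ → tt }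

copies : ℕ → SPGame → SPGame
copies zero    S = emptyBoard
copies (suc k) S = SumGame.game S (copies k S)

copies-value : ∀ k {S G} → spValue S ≃ G → spValue (copies k S) ≃ multG k G
copies-value zero    S≃G = ⊴-refl zeroG , ⊴-refl zeroG
copies-value (suc k) S≃G = ≃-trans (SumGame.sum-value _ (copies k _)) (+G-≃ S≃G (copies-value k S≃G))

mainTheorem8 : (a : ℤ) (n : ℕ) → Σ SPGame (λ S → spValue S =G dyadic a n)
mainTheorem8 (+ k)    n = copies k (HalfPowGame.game n) , ≃⇒=G (copies-value k (HalfPowGame.halfPow-value n))
mainTheorem8 -[1+ k ] n = SwapGame.game (copies (suc k) (HalfPowGame.game n)) ,
  ≃⇒=G (≃-trans (SwapGame.negG-value _) (negG-≃ (copies-value (suc k) (HalfPowGame.halfPow-value n))))
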